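{- Let $n,k$ be positive integers. A restraint $r$ on the complete graph $K_n$ is a proper $k$-restraint if and only if $r\in R_{\max}(K_n,k)$.
   Context: A restraint $r$ on a graph $G$ assigns to each vertex $v$ a finite set $r(v)\subset\mathbb{N}$ of forbidden colours; a proper $x$-colouring $c$ of $G$ is permitted by $r$ if $c(v)\notin r(v)$ for all $v$, and $\pi_r(G,x)$ denotes the number of proper $x$-colourings permitted by $r$. If $G$ has $n$ vertices, a $k$-restraint is a restraint with $|r(v)|=k$ and $r(v)\subseteq\{1,2,\dots,kn\}$ for every vertex $v$. A restraint is proper if $r(u)\cap r(v)=\emptyset$ for every edge $uv$. $R_{\max}(G,k)$ is the set of $k$-restraints $r$ on $G$ such that for every $k$-restraint $r'$ on $G$, $\pi_r(G,x)\geq\pi_{r'}(G,x)$ for all sufficiently large $x$. -}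

module Defs where

import Data.Nat
open import Data.Nat using (ℕ; zero; suc; _≤_; _≡ᵇ_)
open import Data.Bool using (Bool; true; false; _∧_; _∨_; not; if_then_else_)
open import Data.Fin using (Fin; toℕ)
open import Data.Vec using (Vec; []; _∷_; lookup)
import Data.List as List
open import Data.List using (List; [_]; map; concatMap; allFin; length)
open import Data.Bool.ListAction using (all; any)
open import Data.List.Membership.Propositional using (_∈_; _∉_)
open import Data.List.Relation.Unary.Unique.Propositional using (Unique)
open import Data.List.Relation.Unary.All as All using ()
open import Data.Product using (_×_; ∃)
open import Relation.Binary.PropositionalEquality using (_≡_; _≢_)

-- Vertices of K_n are Fin n; every pair of distinct vertices is an edge.
-- A restraint on K_n: each vertex gets a finite set of forbidden colours,
-- represented as a list of natural numbers.
Restraint : ℕ → Set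
Restraint n = Fin n → List ℕ

IsKRestraint : (n k : ℕ) → Restraint n → Set
IsKRestraint n k r =
  (v : Fin n) → Unique (r v) × length (r v) ≡ k
              × All.All (λ a → 1 ≤ a × a ≤ k Data.Nat.* n) (r v)

IsProper : (n : ℕ) → Restraint n → Set
IsProper n r = (u v : Fin n) → u ≢ v → (a : ℕ) → a ∈ r u → a ∉ r v

-- All functions Fin n → Fin x, as vectors (colour of vertex i is 1 + toℕ (lookup c i),
-- so colours range over {1,…,x}).
allVecs : (x n : ℕ) → List (Vec (Fin x) n)
allVecs x zero = [ [] ]
allVecs x (suc n) = concatMap (λ i → map (i ∷_) (allVecs x n)) (allFin x)

colour : {x n : ℕ} → Vec (Fin x) n → Fin n → ℕ
colour c i = suc (toℕ (lookup c i))

isProperColouring : {x n : ℕ} → Vec (Fin x) n → Bool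
isProperColouring {x} {n} c =
  all (λ i → all (λ j → (toℕ i ≡ᵇ toℕ j) ∨ not (colour c i ≡ᵇ colour c j)) (allFin n)) (allFin n)

isPermitted : {x n : ℕ} → Restraint n → Vec (Fin x) n → Bool
isPermitted {x} {n} r c = all (λ i → not (any (λ a → a ≡ᵇ colour c i) (r i))) (allFin n)

countTrue : {A : Set} → (A → Bool) → List A → ℕ
countTrue p List.[] = 0
countTrue p (a List.∷ as) = if p a then suc (countTrue p as) else countTrue p as

πr : (n : ℕ) → Restraint n → ℕ → ℕ
πr n r x = countTrue (λ c → isProperColouring c ∧ isPermitted r c) (allVecs x n)

InRmax : (n k : ℕ) → Restraint n → Set
InRmax n k r =
  IsKRestraint n k r ×
  ((r' : Restraint n) → IsKRestraint n k r' →
     ∃ λ N → (x : ℕ) → N ≤ x → πr n r' x ≤ πr n r x)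

-- π_r(K_n, x) counts the injective colourings c with c(v) ∉ r(v), and any two restraints are compared
-- through injections between their admissible colourings. If two vertices u ≠ v of a k-restraint r
-- share a forbidden colour a, then r uses at most kn − 1 distinct colours, so some colour b ≤ kn is
-- forbidden nowhere. Replacing a by b in r(v) gives a k-restraint r′ with π_r < π_{r′} once x ≥ kn + n:
-- colourings with b at v are repaired by swapping the colours a and b, and the colouring with a at v,
-- b at u and fresh colours elsewhere is new. So a maximal restraint is proper. Conversely, such
-- replacements (each using up a previously unused colour) turn any k-restraint into a proper one, and
-- for proper p, q a transposition of colours (which never decreases π) moves p closer to q;
-- once q(w) ⊆ p(w) for all w, π_p ≤ π_q.
module Submission where

open import Defs
open import Data.Bool using (Bool; true; false; not; T; _∧_; _∨_)
open import Data.Bool.ListAction using (all; any)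
open import Data.Bool.Properties using (T?; T-∧; T-∨)
open import Data.Empty using (⊥-elim)
open import Data.Fin using (Fin; zero; suc; toℕ; fromℕ<)
import Data.Fin as Fin
open import Data.Fin.Properties using (toℕ-injective; toℕ-fromℕ<; toℕ<n; injective⇒≤)
import Data.Fin.Properties as Fin
open import Data.List using (List; []; _∷_; map; length; lookup; filter; filterᵇ; allFin; concatMap; applyUpTo; cartesianProduct)
open import Data.List.Properties using (length-map; length-++; length-filter; filter-notAll; length-tabulate; length-applyUpTo)
open import Data.List.Membership.Propositional using (_∈_; _∉_; find; lose)
open import Data.List.Membership.Propositional.Properties
  using (∈-lookup; ∈-filter⁺; ∈-filter⁻; ∈-allFin; ∈-map⁺; ∈-map⁻; ∈-concatMap⁺; ∈-applyUpTo⁺; ∈-applyUpTo⁻; ∈-cartesianProduct⁺)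
open import Data.List.Relation.Binary.Disjoint.Propositional using (Disjoint)
open import Data.List.Relation.Binary.Subset.Propositional using (_⊆_)
import Data.List.Relation.Unary.All as All
open All using (All; []; _∷_)
open import Data.List.Relation.Unary.All.Properties as All using (all⁺; all⁻; all-filter; ¬All⇒Any¬)
import Data.List.Relation.Unary.AllPairs as AllPairs
import Data.List.Relation.Unary.AllPairs.Properties as AllPairs
import Data.List.Relation.Unary.Any as Any
open Any using (here; there; index)
open import Data.List.Relation.Unary.Any.Properties using (any⁺; any⁻; lookup-index)
open import Data.List.Relation.Unary.Unique.Propositional using (Unique; []; _∷_)
open import Data.List.Relation.Unary.Unique.Propositional.Properties
  using (map⁺; filter⁺; concat⁺; allFin⁺; applyUpTo⁺₁; cartesianProduct⁺)
open import Data.Nat using (ℕ; zero; suc; _+_; _*_; _≤_; _<_; z≤n; s≤s; _≡ᵇ_)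
import Data.Nat as ℕ
open import Data.List.Membership.DecPropositional ℕ._≟_ using (_∈?_)
open import Data.Nat.Induction using (<-wellFounded)
open import Data.Nat.Properties
  using ( ≡ᵇ⇒≡; ≡⇒≡ᵇ; suc-injective; ≤-trans; ≤-reflexive; <-≤-trans; ≤-<-trans; <⇒≤; <⇒≢; <⇒≱; m≤m+n; m≤n+m
        ; +-mono-≤; +-mono-<-≤; +-mono-≤-<; +-monoʳ-<; +-cancelˡ-≡; *-comm)
open import Data.Product using (_×_; _,_; ∃; proj₁; proj₂)
open import Data.Sum using (_⊎_; inj₁; inj₂)
open import Data.Vec using (Vec; []; _∷_)
import Data.Vec as Vec
open import Data.Vec.Properties using (∷-injectiveˡ; ∷-injectiveʳ; lookup-map; lookup∘tabulate; map-∘; map-cong; map-id)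
open import Data.Vec.Functional using (updateAt)
open import Data.Vec.Functional.Properties using (updateAt-updates; updateAt-minimal)
open import Function using (id; _∘_)
open import Function.Bundles using (_⇔_; mk⇔; Equivalence)
import Induction.WellFounded as WF
import Relation.Binary.Construct.On as On
open import Relation.Binary.Definitions using (DecidableEquality)
open import Relation.Binary.PropositionalEquality using (_≡_; _≢_; refl; sym; trans; cong; subst; module ≡-Reasoning)
open import Relation.Nullary using (¬_; yes; no; ¬?)
open import Relation.Nullary.Decidable using (True; isYes; toWitness; fromWitness; decidable-stable; _×-dec_)
open import Relation.Unary using (Decidable)

-- Counting with unique lists

module _ {A : Set} where

  Unique⇒lookup-injective : ∀ {xs : List A} → Unique xs → ∀ {i j} → lookup xs i ≡ lookup xs j → i ≡ j
  Unique⇒lookup-injective (x∉xs ∷ u) {zero}  {zero}  _  = refl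
  Unique⇒lookup-injective (x∉xs ∷ u) {zero}  {suc j} eq = ⊥-elim (All.lookup x∉xs (∈-lookup j) eq)
  Unique⇒lookup-injective (x∉xs ∷ u) {suc i} {zero}  eq = ⊥-elim (All.lookup x∉xs (∈-lookup i) (sym eq))
  Unique⇒lookup-injective (x∉xs ∷ u) {suc i} {suc j} eq = cong suc (Unique⇒lookup-injective u eq)

  Unique-⊆⇒length-≤ : ∀ {xs ys : List A} → Unique xs → xs ⊆ ys → length xs ≤ length ys
  Unique-⊆⇒length-≤ {xs} {ys} u xs⊆ys = injective⇒≤ position-injective
    where
    position : Fin (length xs) → Fin (length ys)
    position i = index (xs⊆ys (∈-lookup i))
    position-injective : ∀ {i j} → position i ≡ position j → i ≡ j
    position-injective {i} {j} eq = Unique⇒lookup-injective u (begin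
      lookup xs i              ≡⟨ lookup-index (xs⊆ys (∈-lookup i)) ⟩
      lookup ys (position i)   ≡⟨ cong (lookup ys) eq ⟩
      lookup ys (position j)   ≡⟨ lookup-index (xs⊆ys (∈-lookup j)) ⟨
      lookup xs j              ∎)
      where open ≡-Reasoning

  map-Unique : ∀ {P : A → Set} {f : A → A} {xs} →
    (∀ {a b} → P a → P b → f a ≡ f b → a ≡ b) → All P xs → Unique xs → Unique (map f xs)
  map-Unique inj []        []         = []
  map-Unique inj (pa ∷ ps) (a∉xs ∷ u) =
    All.map⁺ (All.zipWith (λ (pb , a≢b) fa≡fb → a≢b (inj pa pb fa≡fb)) (ps , a∉xs)) ∷ map-Unique inj ps u

  countTrue≡length-filterᵇ : (p : A → Bool) (xs : List A) → countTrue p xs ≡ length (filterᵇ p xs)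
  countTrue≡length-filterᵇ p []       = refl
  countTrue≡length-filterᵇ p (x ∷ xs) with p x
  ... | true  = cong suc (countTrue≡length-filterᵇ p xs)
  ... | false = countTrue≡length-filterᵇ p xs

  Unique⇒length-≤-countTrue : ∀ {q : A → Bool} {xs ys} → Unique ys →
    (∀ {y} → y ∈ ys → y ∈ xs × T (q y)) → length ys ≤ countTrue q xs
  Unique⇒length-≤-countTrue {q} {xs} u into =
    subst (_ ≤_) (sym (countTrue≡length-filterᵇ q xs))
      (Unique-⊆⇒length-≤ u (λ y∈ys → let (y∈xs , qy) = into y∈ys in ∈-filter⁺ (T? ∘ q) y∈xs qy))

  count : {P : A → Set} → Decidable P → List A → ℕ
  count P? = countTrue (isYes ∘ P?)

  count-< : ∀ {P Q : A → Set} (P? : Decidable P) (Q? : Decidable Q) {xs z} → Unique xs →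
    (∀ {a} → a ∈ xs → P a → Q a) → z ∈ xs → ¬ P z → Q z → count P? xs < count Q? xs
  count-< P? Q? {xs} {z} u P⇒Q z∈xs ¬pz qz =
    subst (λ m → suc m ≤ count Q? xs) (sym (countTrue≡length-filterᵇ _ xs))
      (Unique⇒length-≤-countTrue (All.tabulate z≢ ∷ filter⁺ (T? ∘ isYes ∘ P?) u) into)
    where
    z≢ : ∀ {a} → a ∈ filterᵇ (isYes ∘ P?) xs → z ≢ a
    z≢ a∈ refl = ¬pz (toWitness {a? = P? z} (proj₂ (∈-filter⁻ (T? ∘ isYes ∘ P?) {xs = xs} a∈)))
    into : ∀ {a} → a ∈ z ∷ filterᵇ (isYes ∘ P?) xs → a ∈ xs × True (Q? a)
    into (here refl)     = z∈xs , fromWitness {a? = Q? z} qz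
    into {a} (there a∈) with a∈xs , pa ← ∈-filter⁻ (T? ∘ isYes ∘ P?) {xs = xs} a∈
      = a∈xs , fromWitness {a? = Q? a} (P⇒Q a∈xs (toWitness {a? = P? a} pa))

∃-∉ : ∀ {xs ys : List ℕ} {b} → Unique xs → length ys ≤ length xs → b ∈ ys → b ∉ xs →
  ∃ λ a → a ∈ xs × a ∉ ys
∃-∉ {xs} {ys} {b} xs-unique ys≤xs b∈ys b∉xs with All.all? (_∈? ys) xs
... | yes xs⊆ys = ⊥-elim (<⇒≱ (Unique-⊆⇒length-≤ (All.tabulate b≢ ∷ xs-unique) b∷xs⊆ys) ys≤xs)
  where
  b≢ : ∀ {a} → a ∈ xs → b ≢ a
  b≢ a∈xs refl = b∉xs a∈xs
  b∷xs⊆ys : b ∷ xs ⊆ ys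
  b∷xs⊆ys (here refl)  = b∈ys
  b∷xs⊆ys (there a∈xs) = All.lookup xs⊆ys a∈xs
... | no ¬xs⊆ys = find (¬All⇒Any¬ (_∈? ys) xs ¬xs⊆ys)

module _ {A B : Set} {f : A → List B} {k : ℕ} (bounded : ∀ a → length (f a) ≤ k) where

  length-concatMap-≤ : ∀ xs → length (concatMap f xs) ≤ length xs * k
  length-concatMap-≤ []       = z≤n
  length-concatMap-≤ (x ∷ xs) = subst (_≤ k + length xs * k) (sym (length-++ (f x)))
    (+-mono-≤ (bounded x) (length-concatMap-≤ xs))

  length-concatMap-< : ∀ {v xs} → v ∈ xs → length (f v) < k → length (concatMap f xs) < length xs * k
  length-concatMap-< {xs = x ∷ xs} (here refl) short = subst (_< k + length xs * k) (sym (length-++ (f x)))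
    (+-mono-<-≤ short (length-concatMap-≤ xs))
  length-concatMap-< {xs = x ∷ xs} (there v∈) short = subst (_< k + length xs * k) (sym (length-++ (f x)))
    (+-mono-≤-< (bounded x) (length-concatMap-< v∈ short))

measure-induction : ∀ {A : Set} (μ : A → ℕ) (P : A → Set) →
  (∀ a → (∀ b → μ b < μ a → P b) → P a) → ∀ a → P a
measure-induction μ P step = WF.All.wfRec (On.wellFounded μ <-wellFounded) _ P (λ a rec → step a (λ b → rec))

-- Transpositions

module Transposition {A : Set} (_≟_ : DecidableEquality A) where

  transpose : A → A → A → A
  transpose a b y with y ≟ a | y ≟ b
  ... | yes _ | _     = b
  ... | no _  | yes _ = a
  ... | no _  | no _  = y

  transpose-matchˡ : ∀ a b → transpose a b a ≡ b
  transpose-matchˡ a b with a ≟ a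
  ... | yes _  = refl
  ... | no a≢a = ⊥-elim (a≢a refl)

  transpose-matchʳ : ∀ a b → transpose a b b ≡ a
  transpose-matchʳ a b with b ≟ a | b ≟ b
  ... | yes b≡a | _      = b≡a
  ... | no _    | yes _  = refl
  ... | no _    | no b≢b = ⊥-elim (b≢b refl)

  transpose-mismatch : ∀ {a b y} → y ≢ a → y ≢ b → transpose a b y ≡ y
  transpose-mismatch {a} {b} {y} y≢a y≢b with y ≟ a | y ≟ b
  ... | yes y≡a | _       = ⊥-elim (y≢a y≡a)
  ... | no _    | yes y≡b = ⊥-elim (y≢b y≡b)
  ... | no _    | no _    = refl

  transpose-involutive : ∀ a b y → transpose a b (transpose a b y) ≡ y
  transpose-involutive a b y with y ≟ a | y ≟ b
  ... | yes refl | _        = transpose-matchʳ a b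
  ... | no _     | yes refl = transpose-matchˡ a b
  ... | no y≢a   | no y≢b   = transpose-mismatch y≢a y≢b

  transpose-injective : ∀ a b {y z} → transpose a b y ≡ transpose a b z → y ≡ z
  transpose-injective a b {y} {z} eq = begin
    y                                ≡⟨ transpose-involutive a b y ⟨
    transpose a b (transpose a b y)  ≡⟨ cong (transpose a b) eq ⟩
    transpose a b (transpose a b z)  ≡⟨ transpose-involutive a b z ⟩
    z                                ∎
    where open ≡-Reasoning

  transpose-preserves : ∀ (P : A → Set) {a b y} → P a → P b → P y → P (transpose a b y)
  transpose-preserves P {a} {b} {y} pa pb py with y ≟ a | y ≟ b
  ... | yes _ | _     = pb
  ... | no _  | yes _ = pa
  ... | no _  | no _  = py

  transpose-∉ : ∀ {a b y} {L : List A} → b ∉ L → y ∉ L → y ≢ b → transpose a b y ∉ L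
  transpose-∉ {a} {b} {y} b∉L y∉L y≢b with y ≟ a | y ≟ b
  ... | yes _ | _       = b∉L
  ... | no _  | yes y≡b = ⊥-elim (y≢b y≡b)
  ... | no _  | no _    = y∉L

  ∈-map-transpose⁻ : ∀ {a b y L} → y ∈ map (transpose a b) L → transpose a b y ∈ L
  ∈-map-transpose⁻ {a} {b} {L = L} y∈ with ∈-map⁻ (transpose a b) y∈
  ... | z , z∈L , refl = subst (_∈ L) (sym (transpose-involutive a b z)) z∈L

module _ {A B : Set} (_≟ᴬ_ : DecidableEquality A) (_≟ᴮ_ : DecidableEquality B) where

  open Transposition _≟ᴬ_ renaming (transpose to transposeᴬ)
  open Transposition _≟ᴮ_ renaming (transpose to transposeᴮ)

  transpose-natural : ∀ {f : A → B} → (∀ {y z} → f y ≡ f z → y ≡ z) →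
    ∀ a b y → f (transposeᴬ a b y) ≡ transposeᴮ (f a) (f b) (f y)
  transpose-natural {f} f-inj a b y with y ≟ᴬ a | y ≟ᴬ b | f y ≟ᴮ f a | f y ≟ᴮ f b
  ... | yes refl | _        | yes _     | _         = refl
  ... | yes refl | _        | no fy≢fa  | _         = ⊥-elim (fy≢fa refl)
  ... | no y≢a   | _        | yes fy≡fa | _         = ⊥-elim (y≢a (f-inj fy≡fa))
  ... | no _     | yes refl | no _      | yes _     = refl
  ... | no _     | yes refl | no _      | no fy≢fb  = ⊥-elim (fy≢fb refl)
  ... | no _     | no y≢b   | no _      | yes fy≡fb = ⊥-elim (y≢b (f-inj fy≡fb))
  ... | no _     | no _     | no _      | no _      = refl

open Transposition ℕ._≟_

module _ {x : ℕ} where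
  open Transposition (Fin._≟_ {x}) public
    using () renaming (transpose to transposeFin; transpose-involutive to transposeFin-involutive)

-- Colourings

toColour : ∀ {x} → Fin x → ℕ
toColour i = suc (toℕ i)

toColour-injective : ∀ {x} {i j : Fin x} → toColour i ≡ toColour j → i ≡ j
toColour-injective = toℕ-injective ∘ suc-injective

InRange : ℕ → ℕ → Set
InRange M y = 1 ≤ y × y ≤ M

toColour-onto : ∀ {M x y} → InRange M y → M ≤ x → ∃ λ (i : Fin x) → toColour i ≡ y
toColour-onto {y = suc y} (_ , y<M) M≤x = fromℕ< y<x , cong suc (toℕ-fromℕ< y<x)
  where y<x = ≤-trans y<M M≤x

Colouring : ℕ → ℕ → Set
Colouring x n = Vec (Fin x) n

module _ {x n : ℕ} where

  ProperColouring : Colouring x n → Set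
  ProperColouring c = ∀ {i j} → colour c i ≡ colour c j → i ≡ j

  Permitted : Restraint n → Colouring x n → Set
  Permitted r c = ∀ i → colour c i ∉ r i

  Admissible : Restraint n → Colouring x n → Set
  Admissible r c = ProperColouring c × Permitted r c

T-not : ∀ {b} → T (not b) ⇔ (¬ T b)
T-not {true}  = mk⇔ (λ ()) (λ ¬t → ¬t _)
T-not {false} = mk⇔ (λ _ ()) (λ _ → _)

T-any-≡ᵇ : ∀ {y : ℕ} {L : List ℕ} → T (any (λ a → a ≡ᵇ y) L) ⇔ y ∈ L
T-any-≡ᵇ {y} {L} = mk⇔
  (Any.map (λ {a} t → sym (≡ᵇ⇒≡ a y t)) ∘ any⁻ _ L)
  (any⁺ _ ∘ Any.map (λ {a} y≡a → ≡⇒≡ᵇ a y (sym y≡a)))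

module _ {x n : ℕ} where

  T-isProperColouring : {c : Colouring x n} → T (isProperColouring c) ⇔ ProperColouring c
  T-isProperColouring {c} = mk⇔ to from
    where
    sameOrDistinct : Fin n → Fin n → Bool
    sameOrDistinct i j = (toℕ i ≡ᵇ toℕ j) ∨ not (colour c i ≡ᵇ colour c j)
    to : T (isProperColouring c) → ProperColouring c
    to t {i} {j} ci≡cj
      with Equivalence.to T-∨ (All.lookup (all⁺ _ _ (All.lookup (all⁺ _ _ t) (∈-allFin i))) (∈-allFin j))
    ... | inj₁ i≡ᵇj   = toℕ-injective (≡ᵇ⇒≡ _ _ i≡ᵇj)
    ... | inj₂ ci≢ᵇcj = ⊥-elim (Equivalence.to T-not ci≢ᵇcj (≡⇒≡ᵇ _ _ ci≡cj))
    from : ProperColouring c → T (isProperColouring c)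
    from proper = all⁻ (λ i → all (sameOrDistinct i) (allFin n)) {allFin n}
      (All.universal (λ i → all⁻ (sameOrDistinct i) {allFin n} (All.universal (holds i) _)) _)
      where
      holds : ∀ i j → T (sameOrDistinct i j)
      holds i j with T? (colour c i ≡ᵇ colour c j)
      ... | yes t = Equivalence.from T-∨ (inj₁ (≡⇒≡ᵇ _ _ (cong toℕ (proper (≡ᵇ⇒≡ _ _ t)))))
      ... | no ¬t = Equivalence.from T-∨ (inj₂ (Equivalence.from T-not ¬t))

  T-isPermitted : {r : Restraint n} {c : Colouring x n} → T (isPermitted r c) ⇔ Permitted r c
  T-isPermitted {r} {c} = mk⇔
    (λ t i → Equivalence.to T-not (All.lookup (all⁺ _ _ t) (∈-allFin i)) ∘ Equivalence.from T-any-≡ᵇ)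
    (λ permitted → all⁻ (λ i → not (any (λ a → a ≡ᵇ colour c i) (r i))) {allFin n}
      (All.universal (λ i → Equivalence.from T-not (permitted i ∘ Equivalence.to T-any-≡ᵇ)) _))

  T-admissible : (r : Restraint n) (c : Colouring x n) →
    T (isProperColouring c ∧ isPermitted r c) ⇔ Admissible r c
  T-admissible r c = mk⇔
    (λ t → let (proper , permitted) = Equivalence.to T-∧ t
           in (λ {i} {j} → Equivalence.to (T-isProperColouring {c}) proper {i} {j}) ,
              Equivalence.to (T-isPermitted {r} {c}) permitted)
    (λ (proper , permitted) → Equivalence.from T-∧
      (Equivalence.from (T-isProperColouring {c}) (λ {i} {j} → proper {i} {j}) ,
       Equivalence.from (T-isPermitted {r} {c}) permitted))

allVecs-complete : ∀ {x n} (c : Colouring x n) → c ∈ allVecs x n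
allVecs-complete []                  = here refl
allVecs-complete {x} {suc n} (i ∷ c) =
  ∈-concatMap⁺ (λ j → map (j ∷_) (allVecs x n)) (lose (∈-allFin i) (∈-map⁺ (i ∷_) (allVecs-complete c)))

allVecs-unique : ∀ x n → Unique (allVecs x n)
allVecs-unique x zero    = [] ∷ []
allVecs-unique x (suc n) =
  concat⁺ (All.map⁺ (All.universal (λ i → map⁺ ∷-injectiveʳ (allVecs-unique x n)) _))
          (AllPairs.map⁺ (AllPairs.map disjoint (allFin⁺ x)))
  where
  disjoint : ∀ {i j} → i ≢ j → Disjoint (map (i ∷_) (allVecs x n)) (map (j ∷_) (allVecs x n))
  disjoint i≢j (c∈i , c∈j) with ∈-map⁻ _ c∈i | ∈-map⁻ _ c∈j
  ... | _ , _ , refl | _ , _ , eq = i≢j (∷-injectiveˡ eq)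

record AdmissibleInjection {n : ℕ} (r r′ : Restraint n) (x : ℕ) : Set where
  field
    to         : Colouring x n → Colouring x n
    admissible : ∀ {c} → Admissible r c → Admissible r′ (to c)
    injective  : ∀ {c c′} → Admissible r c → Admissible r c′ → to c ≡ to c′ → c ≡ c′

module _ {n x : ℕ} {r r′ : Restraint n} (ι : AdmissibleInjection r r′ x) where

  open AdmissibleInjection ι

  private
    good : Restraint n → Colouring x n → Bool
    good s c = isProperColouring c ∧ isPermitted s c

    admissibles : List (Colouring x n)
    admissibles = filterᵇ (good r) (allVecs x n)

    image : List (Colouring x n)
    image = map to admissibles

    admissibles-admissible : All (Admissible r) admissibles
    admissibles-admissible =
      All.map (λ {c} → Equivalence.to (T-admissible r c)) (all-filter (T? ∘ good r) (allVecs x n))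

    image-unique : Unique image
    image-unique = map-Unique injective admissibles-admissible (filter⁺ (T? ∘ good r) (allVecs-unique x n))

    image-length : length image ≡ πr n r x
    image-length = trans (length-map to admissibles) (sym (countTrue≡length-filterᵇ (good r) (allVecs x n)))

    image-∈⁻ : ∀ {c} → c ∈ image → ∃ λ c′ → Admissible r c′ × c ≡ to c′
    image-∈⁻ c∈image with ∈-map⁻ to c∈image
    ... | c′ , c′∈ , refl = c′ , All.lookup admissibles-admissible c′∈ , refl

    image-admissible : ∀ {c} → c ∈ image → c ∈ allVecs x n × T (good r′ c)
    image-admissible c∈image with image-∈⁻ c∈image
    ... | c′ , adm , refl = allVecs-complete _ , Equivalence.from (T-admissible r′ (to c′)) (admissible {c′} adm)

  πr-mono : πr n r x ≤ πr n r′ x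
  πr-mono = subst (_≤ πr n r′ x) image-length (Unique⇒length-≤-countTrue image-unique image-admissible)

  πr-mono-< : ∀ {d} → Admissible r′ d → (∀ {c} → Admissible r c → to c ≢ d) → πr n r x < πr n r′ x
  πr-mono-< {d} d-admissible d∉image =
    subst (λ m → suc m ≤ πr n r′ x) image-length
      (Unique⇒length-≤-countTrue (All.tabulate d≢ ∷ image-unique) d∷image-admissible)
    where
    d≢ : ∀ {c} → c ∈ image → d ≢ c
    d≢ c∈image d≡c with image-∈⁻ c∈image
    ... | c′ , adm , refl = d∉image adm (sym d≡c)
    d∷image-admissible : ∀ {c} → c ∈ d ∷ image → c ∈ allVecs x n × T (good r′ c)
    d∷image-admissible (here refl)     = allVecs-complete d , Equivalence.from (T-admissible r′ d) d-admissible
    d∷image-admissible (there c∈image) = image-admissible c∈image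

module _ {x n : ℕ} where

  transposeColours : Fin x → Fin x → Colouring x n → Colouring x n
  transposeColours a b c = Vec.map (transposeFin a b) c

  colour-transposeColours : ∀ (a b : Fin x) (c : Colouring x n) i →
    colour (transposeColours a b c) i ≡ transpose (toColour a) (toColour b) (colour c i)
  colour-transposeColours a b c i = begin
    toColour (Vec.lookup (Vec.map (transposeFin a b) c) i)  ≡⟨ cong toColour (lookup-map i _ c) ⟩
    toColour (transposeFin a b (Vec.lookup c i))            ≡⟨ transpose-natural Fin._≟_ ℕ._≟_ toColour-injective a b _ ⟩
    transpose (toColour a) (toColour b) (colour c i)        ∎
    where open ≡-Reasoning

  transposeColours-proper : ∀ (a b : Fin x) {c : Colouring x n} →
    ProperColouring c → ProperColouring (transposeColours a b c)
  transposeColours-proper a b {c} proper {i} {j} eq = proper (transpose-injective (toColour a) (toColour b)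
    (trans (sym (colour-transposeColours a b c i)) (trans eq (colour-transposeColours a b c j))))

  transposeColours-involutive : ∀ (a b : Fin x) (c : Colouring x n) →
    transposeColours a b (transposeColours a b c) ≡ c
  transposeColours-involutive a b c = begin
    Vec.map τ (Vec.map τ c)  ≡⟨ map-∘ τ τ c ⟨
    Vec.map (τ ∘ τ) c        ≡⟨ map-cong (transposeFin-involutive a b) c ⟩
    Vec.map id c             ≡⟨ map-id c ⟩
    c                        ∎
    where
    open ≡-Reasoning
    τ = transposeFin a b

  transposeColours-injective : ∀ (a b : Fin x) {c c′ : Colouring x n} →
    transposeColours a b c ≡ transposeColours a b c′ → c ≡ c′
  transposeColours-injective a b {c} {c′} eq = begin
    c         ≡⟨ transposeColours-involutive a b c ⟨
    τ* (τ* c)  ≡⟨ cong τ* eq ⟩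
    τ* (τ* c′) ≡⟨ transposeColours-involutive a b c′ ⟩
    c′        ∎
    where
    open ≡-Reasoning
    τ* = transposeColours a b

-- Restraints and moves between them

module _ {n : ℕ} where

  transposeRestraint : ℕ → ℕ → Restraint n → Restraint n
  transposeRestraint a b r w = map (transpose a b) (r w)

  recolourAt : Fin n → ℕ → ℕ → Restraint n → Restraint n
  recolourAt v a b r = updateAt r v (map (transpose a b))

  Used : Restraint n → ℕ → Set
  Used r y = ∃ λ w → y ∈ r w

  used? : (r : Restraint n) → Decidable (Used r)
  used? r y = Fin.any? (λ w → y ∈? r w)

  Shared : Restraint n → Set
  Shared r = ∃ λ u → ∃ λ v → u ≢ v × ∃ λ a → a ∈ r u × a ∈ r v

  proper-or-shared : (r : Restraint n) → IsProper n r ⊎ Shared r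
  proper-or-shared r with Fin.any? (λ u → Fin.any? (λ v → ¬? (u Fin.≟ v) ×-dec Any.any? (_∈? r v) (r u)))
  ... | yes (u , v , u≢v , common) = inj₂ (u , v , u≢v , find common)
  ... | no ¬shared = inj₁ λ u v u≢v a a∈ru a∈rv → ¬shared (u , v , u≢v , lose a∈ru a∈rv)

  proper-owner : ∀ {r u v y} → IsProper n r → y ∈ r u → y ∈ r v → u ≡ v
  proper-owner {u = u} {v} proper y∈u y∈v with u Fin.≟ v
  ... | yes u≡v = u≡v
  ... | no u≢v  = ⊥-elim (proper u v u≢v _ y∈u y∈v)

  Mismatch : Restraint n → Restraint n → Fin n × ℕ → Set
  Mismatch q p (w , y) = y ∈ q w × y ∉ p w

  mismatch? : (q p : Restraint n) → Decidable (Mismatch q p)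
  mismatch? q p (w , y) = (y ∈? q w) ×-dec ¬? (y ∈? p w)

  ⊆-or-mismatch : (p q : Restraint n) → (∀ w → q w ⊆ p w) ⊎ ∃ λ v → ∃ λ b → b ∈ q v × b ∉ p v
  ⊆-or-mismatch p q with Fin.any? (λ w → Any.any? (λ y → ¬? (y ∈? p w)) (q w))
  ... | yes (v , missing) = inj₂ (v , find missing)
  ... | no none = inj₁ λ w y∈q → decidable-stable (_ ∈? p w) (λ y∉p → none (w , lose y∈q y∉p))

  transposeRestraint-proper : ∀ {a b p} → IsProper n p → IsProper n (transposeRestraint a b p)
  transposeRestraint-proper proper u v u≢v y y∈u y∈v =
    proper u v u≢v _ (∈-map-transpose⁻ y∈u) (∈-map-transpose⁻ y∈v)

  ∈-recolourAt : ∀ {r v a b} → a ∈ r v → b ∈ recolourAt v a b r v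
  ∈-recolourAt {r} {v} {a} {b} a∈rv = subst (b ∈_) (sym (updateAt-updates v r))
    (subst (_∈ map (transpose a b) (r v)) (transpose-matchˡ a b) (∈-map⁺ (transpose a b) a∈rv))

  recolourAt-used : ∀ {r u v a b} → u ≢ v → a ∈ r u → (∀ w → b ∉ r w) →
    ∀ {y} → Used r y → Used (recolourAt v a b r) y
  recolourAt-used {r} {u} {v} {a} {b} u≢v a∈ru b-unused {y} (w , y∈rw) with w Fin.≟ v | y ℕ.≟ a | y ℕ.≟ b
  ... | no w≢v   | _        | _        = w , subst (y ∈_) (sym (updateAt-minimal w v r w≢v)) y∈rw
  ... | yes refl | yes refl | _        = u , subst (y ∈_) (sym (updateAt-minimal u v r u≢v)) a∈ru
  ... | yes refl | no _     | yes refl = ⊥-elim (b-unused w y∈rw)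
  ... | yes refl | no y≢a   | no y≢b   = v , subst (y ∈_) (sym (updateAt-updates v r))
    (subst (_∈ map (transpose a b) (r v)) (transpose-mismatch y≢a y≢b) (∈-map⁺ _ y∈rw))

module _ {x n : ℕ} where

  ⊆-injection : {p q : Restraint n} → (∀ w → q w ⊆ p w) → AdmissibleInjection p q x
  ⊆-injection q⊆p = record
    { to         = id
    ; admissible = λ (proper , permitted) → (λ {i} {j} → proper {i} {j}) , λ i → permitted i ∘ q⊆p i
    ; injective  = λ _ _ → id
    }

  transpose-injection : (p : Restraint n) (a b : Fin x) →
    AdmissibleInjection p (transposeRestraint (toColour a) (toColour b) p) x
  transpose-injection p a b = record
    { to         = transposeColours a b
    ; admissible = λ {c} (proper , permitted) → transposeColours-proper a b {c} proper , λ i c∈ →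
        permitted i (subst (_∈ p i) (transpose-involutive (toColour a) (toColour b) (colour c i))
          (∈-map-transpose⁻ (subst (_∈ _) (colour-transposeColours a b c i) c∈)))
    ; injective  = λ _ _ → transposeColours-injective a b
    }

  module _ (M : ℕ) (room : M + n ≤ x) where

    private
      fresh : Colouring x n
      fresh = Vec.tabulate λ w → fromℕ< (<-≤-trans (+-monoʳ-< M (toℕ<n w)) room)

      colour-fresh : ∀ w → colour fresh w ≡ suc (M + toℕ w)
      colour-fresh w = cong suc (trans (cong toℕ (lookup∘tabulate _ w)) (toℕ-fromℕ< _))

      fresh-proper : ProperColouring fresh
      fresh-proper {i} {j} eq = toℕ-injective (+-cancelˡ-≡ M _ _ (suc-injective
        (trans (sym (colour-fresh i)) (trans eq (colour-fresh j)))))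

      fresh-large : ∀ w → M < colour fresh w
      fresh-large w = subst (M <_) (sym (colour-fresh w)) (s≤s (m≤m+n M (toℕ w)))

    -- Start from the injective colouring w ↦ M + 1 + w and move u to b and v to a by two transpositions.
    pinned-colouring : ∀ {u v} → u ≢ v → (a b : Fin x) → toColour a ≢ toColour b → toColour a ≤ M → toColour b ≤ M →
      ∃ λ d → ProperColouring d × colour d v ≡ toColour a × colour d u ≡ toColour b ×
              (∀ w → w ≢ u → w ≢ v → M < colour d w)
    pinned-colouring {u} {v} u≢v a b A≢B A≤M B≤M = d , d-proper , dv≡A , du≡B , d-large
      where
      A B : ℕ
      A = toColour a
      B = toColour b
      E : Fin n → ℕ
      E = colour fresh
      σ₁ σ₂ : ℕ → ℕ
      σ₁ = transpose (E u) B
      σ₂ = transpose (E v) A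
      d₁ d : Colouring x n
      d₁ = transposeColours (Vec.lookup fresh u) b fresh
      d  = transposeColours (Vec.lookup fresh v) a d₁
      colour-d : ∀ w → colour d w ≡ σ₂ (σ₁ (E w))
      colour-d w = trans (colour-transposeColours _ a d₁ w) (cong σ₂ (colour-transposeColours _ b fresh w))
      d-proper : ProperColouring d
      d-proper = transposeColours-proper _ a {d₁} (transposeColours-proper _ b {fresh} fresh-proper)
      small≢E : ∀ {y} → y ≤ M → ∀ w → E w ≢ y
      small≢E y≤M w = <⇒≢ (≤-<-trans y≤M (fresh-large w)) ∘ sym
      E≢E : ∀ {w w′} → w ≢ w′ → E w ≢ E w′
      E≢E w≢w′ = w≢w′ ∘ fresh-proper
      du≡B : colour d u ≡ B
      du≡B = trans (colour-d u) (trans (cong σ₂ (transpose-matchˡ (E u) B))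
        (transpose-mismatch (small≢E B≤M v ∘ sym) (A≢B ∘ sym)))
      dv≡A : colour d v ≡ A
      dv≡A = trans (colour-d v) (trans (cong σ₂ (transpose-mismatch (E≢E (u≢v ∘ sym)) (small≢E B≤M v)))
        (transpose-matchˡ (E v) A))
      d-large : ∀ w → w ≢ u → w ≢ v → M < colour d w
      d-large w w≢u w≢v = subst (M <_) (sym (trans (colour-d w)
        (trans (cong σ₂ (transpose-mismatch (E≢E w≢u) (small≢E B≤M w))) (transpose-mismatch (E≢E w≢v) (small≢E A≤M w)))))
        (fresh-large w)

  module Recolour (r : Restraint n) (v : Fin n) (a b : Fin x)
                  (a∈rv : toColour a ∈ r v) (b-unused : ∀ w → toColour b ∉ r w) where

    private
      A B : ℕ
      A = toColour a
      B = toColour b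
      τ* : Colouring x n → Colouring x n
      τ* = transposeColours a b

    r′ : Restraint n
    r′ = recolourAt v A B r

    recolour : Colouring x n → Colouring x n
    recolour c with Vec.lookup c v Fin.≟ b
    ... | yes _ = τ* c
    ... | no _  = c

    private
      ∉r′ : ∀ {y} i → (i ≡ v → transpose A B y ∉ r v) → (i ≢ v → y ∉ r i) → y ∉ r′ i
      ∉r′ i at-v elsewhere y∈ with i Fin.≟ v
      ... | yes refl = at-v refl (∈-map-transpose⁻ (subst (_ ∈_) (updateAt-updates v r) y∈))
      ... | no i≢v   = elsewhere i≢v (subst (_ ∈_) (updateAt-minimal i v r i≢v) y∈)

      permitted-swapped : ∀ {c} → Admissible r c → Vec.lookup c v ≡ b → Permitted r′ (τ* c)
      permitted-swapped {c} (proper , permitted) cv≡b i = ∉r′ {colour (τ* c) i} i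
        (λ { refl → subst (_∉ r i) (sym (trans (cong (transpose A B) (colour-transposeColours a b c i))
                      (trans (transpose-involutive A B (colour c i)) (cong toColour cv≡b)))) (b-unused i) })
        (λ i≢v → subst (_∉ r i) (sym (colour-transposeColours a b c i))
          (transpose-∉ {A} (b-unused i) (permitted i) (λ ci≡B → i≢v (proper (trans ci≡B (cong toColour (sym cv≡b)))))))

      permitted-kept : ∀ {c} → Permitted r c → Vec.lookup c v ≢ b → Permitted r′ c
      permitted-kept {c} permitted cv≢b i = ∉r′ {colour c i} i
        (λ { refl → transpose-∉ {A} (b-unused v) (permitted v) (cv≢b ∘ toColour-injective) })
        (λ _ → permitted i)

      swapped≢kept : ∀ {c c′} → Vec.lookup c v ≡ b → Permitted r c′ → τ* c ≢ c′
      swapped≢kept {c} cv≡b permitted′ refl = permitted′ v (subst (_∈ r v) (sym colour≡A) a∈rv)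
        where
        colour≡A : colour (τ* c) v ≡ A
        colour≡A = trans (colour-transposeColours a b c v)
          (trans (cong (λ i → transpose A B (toColour i)) cv≡b) (transpose-matchʳ A B))

    recolour-injection : AdmissibleInjection r r′ x
    recolour-injection = record { to = recolour ; admissible = λ {c} → admissible {c} ; injective = injective }
      where
      admissible : ∀ {c} → Admissible r c → Admissible r′ (recolour c)
      admissible {c} adm@(proper , permitted) with Vec.lookup c v Fin.≟ b
      ... | yes cv≡b = transposeColours-proper a b {c} proper , permitted-swapped {c} adm cv≡b
      ... | no cv≢b  = (λ {i} {j} → proper {i} {j}) , permitted-kept {c} permitted cv≢b
      injective : ∀ {c c′} → Admissible r c → Admissible r c′ → recolour c ≡ recolour c′ → c ≡ c′
      injective {c} {c′} (_ , permitted) (_ , permitted′) eq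
        with Vec.lookup c v Fin.≟ b | Vec.lookup c′ v Fin.≟ b
      ... | yes _    | yes _     = transposeColours-injective a b eq
      ... | yes cv≡b | no _      = ⊥-elim (swapped≢kept {c} cv≡b permitted′ eq)
      ... | no _     | yes c′v≡b = ⊥-elim (swapped≢kept {c′} c′v≡b permitted (sym eq))
      ... | no _     | no _      = eq

    recolour-misses : ∀ {u} → A ∈ r u → ∀ {d} → colour d v ≡ A → colour d u ≡ B →
      ∀ {c} → Admissible r c → recolour c ≢ d
    recolour-misses {u} a∈ru {d} dv≡A du≡B {c} (_ , permitted) eq with Vec.lookup c v Fin.≟ b
    ... | yes _ = permitted u (subst (_∈ r u) (sym cu≡A) a∈ru)
      where
      cu≡A : colour c u ≡ A
      cu≡A = begin
        colour c u                                 ≡⟨ transpose-involutive A B (colour c u) ⟨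
        transpose A B (transpose A B (colour c u)) ≡⟨ cong (transpose A B) (colour-transposeColours a b c u) ⟨
        transpose A B (colour (τ* c) u)            ≡⟨ cong (λ e → transpose A B (colour e u)) eq ⟩
        transpose A B (colour d u)                 ≡⟨ cong (transpose A B) du≡B ⟩
        transpose A B B                            ≡⟨ transpose-matchʳ A B ⟩
        A                                          ∎
        where open ≡-Reasoning
    ... | no _ = permitted v (subst (_∈ r v) (sym (trans (cong (λ e → colour e v) eq) dv≡A)) a∈rv)

    private
      A≢B : A ≢ B
      A≢B A≡B = b-unused v (subst (_∈ r v) A≡B a∈rv)

    πr-recolour-< : ∀ {u} M → u ≢ v → A ∈ r u → M + n ≤ x → A ≤ M → B ≤ M →
      (∀ w {y} → y ∈ r′ w → y ≤ M) → πr n r x < πr n r′ x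
    πr-recolour-< {u} M u≢v a∈ru room A≤M B≤M r′-bounded
      with d , d-proper , dv≡A , du≡B , d-large ← pinned-colouring M room u≢v a b A≢B A≤M B≤M
      = πr-mono-< recolour-injection {d} (d-proper , d-permitted) (λ {c} → recolour-misses a∈ru dv≡A du≡B {c})
      where
      d-permitted : Permitted r′ d
      d-permitted w with w Fin.≟ u | w Fin.≟ v
      ... | yes refl | _        = ∉r′ w (⊥-elim ∘ u≢v) (λ _ → subst (_∉ r w) (sym du≡B) (b-unused w))
      ... | no _     | yes refl = ∉r′ w (λ _ → subst (λ y → transpose A B y ∉ r v) (sym dv≡A)
                                             (subst (_∉ r v) (sym (transpose-matchˡ A B)) (b-unused v)))
                                          (λ w≢v → ⊥-elim (w≢v refl))
      ... | no w≢u   | no w≢v   = λ dw∈ → <⇒≱ (d-large w w≢u w≢v) (r′-bounded w dw∈)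

-- k-restraints

KList : ℕ → ℕ → List ℕ → Set
KList k M L = Unique L × length L ≡ k × All (InRange M) L

KList-transpose : ∀ {k M a b L} → InRange M a → InRange M b → KList k M L → KList k M (map (transpose a b) L)
KList-transpose {a = a} {b} {L} a∈ b∈ (unique , len , inRange) =
  map⁺ (transpose-injective a b) unique ,
  trans (length-map (transpose a b) L) len ,
  All.map⁺ (All.map (transpose-preserves (InRange _) a∈ b∈) inRange)

palette : ℕ → List ℕ
palette M = applyUpTo suc M

palette-unique : ∀ M → Unique (palette M)
palette-unique M = applyUpTo⁺₁ suc M (λ i<j _ → <⇒≢ (s≤s i<j))

∈-palette⁺ : ∀ {M y} → InRange M y → y ∈ palette M
∈-palette⁺ {y = suc y} (_ , y<M) = ∈-applyUpTo⁺ suc y<M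

∈-palette⁻ : ∀ {M y} → y ∈ palette M → InRange M y
∈-palette⁻ y∈ with ∈-applyUpTo⁻ suc y∈
... | _ , i<M , refl = s≤s z≤n , i<M

module KRestraints (n k : ℕ) where

  private
    M : ℕ
    M = k * n

  isKRestraint-inRange : ∀ {r w y} → IsKRestraint n k r → y ∈ r w → InRange M y
  isKRestraint-inRange {w = w} kr y∈ = All.lookup (proj₂ (proj₂ (kr w))) y∈

  isKRestraint-∃-∉ : ∀ {p q v b} → IsKRestraint n k p → IsKRestraint n k q → b ∈ q v → b ∉ p v →
    ∃ λ a → a ∈ p v × a ∉ q v
  isKRestraint-∃-∉ {v = v} kp kq = ∃-∉ (proj₁ (kp v)) (≤-reflexive (trans (proj₁ (proj₂ (kq v))) (sym (proj₁ (proj₂ (kp v))))))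

  transposeRestraint-isKRestraint : ∀ {a b r} → InRange M a → InRange M b →
    IsKRestraint n k r → IsKRestraint n k (transposeRestraint a b r)
  transposeRestraint-isKRestraint a∈ b∈ kr w = KList-transpose a∈ b∈ (kr w)

  recolourAt-isKRestraint : ∀ {v a b r} → InRange M a → InRange M b →
    IsKRestraint n k r → IsKRestraint n k (recolourAt v a b r)
  recolourAt-isKRestraint {v} {r = r} a∈ b∈ kr w with w Fin.≟ v
  ... | yes refl = subst (KList k M) (sym (updateAt-updates w r)) (KList-transpose a∈ b∈ (kr w))
  ... | no w≢v   = subst (KList k M) (sym (updateAt-minimal w v r w≢v)) (kr w)

  -- Deleting the second copy of a shared colour leaves fewer than k n colour slots,
  -- which would still have to cover the whole palette.
  shared⇒¬all-used : ∀ {r} → IsKRestraint n k r → Shared r → ¬ All (Used r) (palette M)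
  shared⇒¬all-used {r} kr (u , v , u≢v , a , a∈ru , a∈rv) all-used =
    <⇒≱ slots<M (subst (_≤ length slots) (length-applyUpTo suc M) (Unique-⊆⇒length-≤ (palette-unique M) covered))
    where
    r⁻ : Restraint n
    r⁻ = updateAt r v (filter (λ y → ¬? (y ℕ.≟ a)))
    slots : List ℕ
    slots = concatMap r⁻ (allFin n)
    length-r⁻ : ∀ w → length (r⁻ w) ≤ k
    length-r⁻ w with w Fin.≟ v
    ... | yes refl = subst (_≤ k) (cong length (sym (updateAt-updates w r)))
                       (≤-trans (length-filter _ (r w)) (≤-reflexive (proj₁ (proj₂ (kr w)))))
    ... | no w≢v   = ≤-reflexive (trans (cong length (updateAt-minimal w v r w≢v)) (proj₁ (proj₂ (kr w))))
    length-r⁻v : length (r⁻ v) < k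
    length-r⁻v = subst (_< k) (cong length (sym (updateAt-updates v r)))
      (<-≤-trans (filter-notAll _ (r v) (lose a∈rv (λ a≢a → a≢a refl))) (≤-reflexive (proj₁ (proj₂ (kr v)))))
    slots<M : length slots < M
    slots<M = subst (length slots <_) (trans (cong (_* k) (length-tabulate (λ (i : Fin n) → i))) (*-comm n k))
      (length-concatMap-< length-r⁻ (∈-allFin v) length-r⁻v)
    still-used : ∀ {y w} → y ∈ r w → Used r⁻ y
    still-used {y} {w} y∈rw with w Fin.≟ v | y ℕ.≟ a
    ... | no w≢v   | _        = w , subst (y ∈_) (sym (updateAt-minimal w v r w≢v)) y∈rw
    ... | yes refl | yes refl = u , subst (y ∈_) (sym (updateAt-minimal u v r u≢v)) a∈ru
    ... | yes refl | no y≢a   = v , subst (y ∈_) (sym (updateAt-updates v r)) (∈-filter⁺ _ y∈rw y≢a)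
    covered : palette M ⊆ slots
    covered y∈ with w , y∈r⁻w ← still-used (proj₂ (All.lookup all-used y∈))
      = ∈-concatMap⁺ r⁻ (lose (∈-allFin w) y∈r⁻w)

  unused-colour : ∀ {r} → IsKRestraint n k r → Shared r → ∃ λ b → b ∈ palette M × ¬ Used r b
  unused-colour {r} kr shared with All.all? (used? r) (palette M)
  ... | yes all-used = ⊥-elim (shared⇒¬all-used kr shared all-used)
  ... | no ¬all-used = find (¬All⇒Any¬ (used? r) (palette M) ¬all-used)

  πr-recolourAt-< : ∀ {r u v a b x} → IsKRestraint n k r → u ≢ v → a ∈ r u → a ∈ r v → (∀ w → b ∉ r w) →
    InRange M b → M + n ≤ x → πr n r x < πr n (recolourAt v a b r) x
  πr-recolourAt-< {r} {u} {v} {a} {b} {x} kr u≢v a∈ru a∈rv b-unused b-range room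
    with a′ , refl ← toColour-onto (isKRestraint-inRange kr a∈rv) (≤-trans (m≤m+n M n) room)
       | b′ , refl ← toColour-onto b-range (≤-trans (m≤m+n M n) room)
    = Recolour.πr-recolour-< r v a′ b′ a∈rv b-unused M u≢v a∈ru room (proj₂ (isKRestraint-inRange kr a∈rv))
        (proj₂ b-range) (λ w y∈ → proj₂ (isKRestraint-inRange kr′ y∈))
    where
    kr′ : IsKRestraint n k (recolourAt v a b r)
    kr′ = recolourAt-isKRestraint (isKRestraint-inRange kr a∈rv) b-range kr

  unusedColours : Restraint n → ℕ
  unusedColours r = count (¬? ∘ used? r) (palette M)

  mismatches : Restraint n → Restraint n → ℕ
  mismatches q p = count (mismatch? q p) (cartesianProduct (allFin n) (palette M))

  record Improvement (r : Restraint n) : Set where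
    field
      restraint    : Restraint n
      isKRestraint : IsKRestraint n k restraint
      fewer-unused : unusedColours restraint < unusedColours r
      πr-<         : ∀ {x} → M + n ≤ x → πr n r x < πr n restraint x

  shared⇒improvement : ∀ {r} → IsKRestraint n k r → Shared r → Improvement r
  shared⇒improvement {r} kr shared@(u , v , u≢v , a , a∈ru , a∈rv)
    with b , b∈palette , b-unused ← unused-colour kr shared
    = record
      { restraint    = recolourAt v a b r
      ; isKRestraint = recolourAt-isKRestraint (isKRestraint-inRange kr a∈rv) (∈-palette⁻ b∈palette) kr
      ; fewer-unused = count-< (¬? ∘ used? (recolourAt v a b r)) (¬? ∘ used? r) (palette-unique M)
          (λ _ unused′ used → unused′ (recolourAt-used u≢v a∈ru b-unused′ used)) b∈palette
          (λ unused′ → unused′ (v , ∈-recolourAt {r = r} a∈rv)) b-unused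
      ; πr-<         = πr-recolourAt-< kr u≢v a∈ru a∈rv b-unused′ (∈-palette⁻ b∈palette)
      }
    where
    b-unused′ : ∀ w → b ∉ r w
    b-unused′ w b∈ = b-unused (w , b∈)

module Extremal (n k x : ℕ) (room : k * n + n ≤ x) where

  open KRestraints n k

  private
    M≤x : k * n ≤ x
    M≤x = ≤-trans (m≤m+n (k * n) n) room

  πr-proper-≤-proper : ∀ {q} → IsKRestraint n k q → IsProper n q →
    ∀ p → IsKRestraint n k p → IsProper n p → πr n p x ≤ πr n q x
  πr-proper-≤-proper {q} kq proper-q = measure-induction (mismatches q)
    (λ p → IsKRestraint n k p → IsProper n p → πr n p x ≤ πr n q x) step
    where
    step : ∀ p → (∀ p′ → mismatches q p′ < mismatches q p → IsKRestraint n k p′ → IsProper n p′ → πr n p′ x ≤ πr n q x) →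
           IsKRestraint n k p → IsProper n p → πr n p x ≤ πr n q x
    step p rec kp proper-p with ⊆-or-mismatch p q
    ... | inj₁ q⊆p = πr-mono (⊆-injection q⊆p)
    ... | inj₂ (v , b , b∈q , b∉p)
      with a , a∈p , a∉q ← isKRestraint-∃-∉ kp kq b∈q b∉p
      with a-range ← isKRestraint-inRange kp a∈p | b-range ← isKRestraint-inRange kq b∈q
      with a′ , refl ← toColour-onto a-range M≤x | b′ , refl ← toColour-onto b-range M≤x
      = ≤-trans (πr-mono (transpose-injection p a′ b′))
          (rec p′ fewer (transposeRestraint-isKRestraint a-range b-range kp) (transposeRestraint-proper proper-p))
      where
      A B : ℕ
      A = toColour a′
      B = toColour b′
      p′ : Restraint n
      p′ = transposeRestraint A B p
      kept : ∀ {w y} → y ∈ q w → y ∈ p w → y ∈ p′ w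
      kept {w} {y} y∈q y∈p with y ℕ.≟ A | y ℕ.≟ B
      ... | yes refl | _        = ⊥-elim (a∉q (subst (λ w → A ∈ q w) (proper-owner proper-p y∈p a∈p) y∈q))
      ... | no _     | yes refl = ⊥-elim (b∉p (subst (λ w → B ∈ p w) (proper-owner proper-q y∈q b∈q) y∈p))
      ... | no y≢A   | no y≢B   = subst (_∈ p′ w) (transpose-mismatch y≢A y≢B) (∈-map⁺ (transpose A B) y∈p)
      fewer : mismatches q p′ < mismatches q p
      fewer = count-< (mismatch? q p′) (mismatch? q p) (cartesianProduct⁺ (allFin⁺ n) (palette-unique (k * n)))
        (λ _ (y∈q , y∉p′) → y∈q , y∉p′ ∘ kept y∈q)
        (∈-cartesianProduct⁺ (∈-allFin v) (∈-palette⁺ b-range))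
        (λ (_ , b∉p′) → b∉p′ (subst (_∈ p′ v) (transpose-matchˡ A B) (∈-map⁺ (transpose A B) a∈p)))
        (b∈q , b∉p)

  πr-≤-proper : ∀ {q} → IsKRestraint n k q → IsProper n q → ∀ r → IsKRestraint n k r → πr n r x ≤ πr n q x
  πr-≤-proper {q} kq proper-q = measure-induction unusedColours (λ r → IsKRestraint n k r → πr n r x ≤ πr n q x) step
    where
    step : ∀ r → (∀ r′ → unusedColours r′ < unusedColours r → IsKRestraint n k r′ → πr n r′ x ≤ πr n q x) →
           IsKRestraint n k r → πr n r x ≤ πr n q x
    step r rec kr with proper-or-shared r
    ... | inj₁ proper-r = πr-proper-≤-proper kq proper-q r kr proper-r
    ... | inj₂ shared   = ≤-trans (<⇒≤ (πr-< room)) (rec restraint fewer-unused isKRestraint)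
      where open Improvement (shared⇒improvement kr shared)

theorem4p2 : (n k : ℕ) → (r : Restraint (suc n)) →
    (IsKRestraint (suc n) (suc k) r × IsProper (suc n) r) ⇔ InRmax (suc n) (suc k) r
theorem4p2 n k r = mk⇔ maximal proper
  where
  N K threshold : ℕ
  N = suc n
  K = suc k
  threshold = K * N + N
  open KRestraints N K
  maximal : IsKRestraint N K r × IsProper N r → InRmax N K r
  maximal (kr , proper-r) = kr , λ r′ kr′ →
    threshold , λ x room → Extremal.πr-≤-proper N K x room kr proper-r r′ kr′
  proper : InRmax N K r → IsKRestraint N K r × IsProper N r
  proper (kr , max) = kr , λ u v u≢v a a∈ru a∈rv →
    let open Improvement (shared⇒improvement kr (u , v , u≢v , a , a∈ru , a∈rv))
        (N₀ , eventually) = max restraint isKRestraint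
    in <⇒≱ (πr-< (m≤n+m threshold N₀)) (eventually (N₀ + threshold) (m≤m+n N₀ threshold))
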